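{- Let $\mathcal{F}_{\mathrm{polyfact}}$ be the family of $3$-graphs $H$ for which there is a constant $C_H$ with $r(H,K_n^{(3)})\le n^{C_H n}$ for all $n\ge 2$. Then $\mathcal{F}_{\mathrm{polyfact}}$ contains all link $3$-graphs $L_G$ (for every graph $G$), is closed under taking subgraphs, and if $H,F\in\mathcal{F}_{\mathrm{polyfact}}$ then $H(v,F)\in\mathcal{F}_{\mathrm{polyfact}}$ for every $v\in V(H)$.
   Context: A $3$-graph is a $3$-uniform hypergraph. For $3$-graphs $H_1,H_2$, $r(H_1,H_2)$ is the smallest $N$ such that every $3$-graph on $N$ vertices contains $H_1$ or its complement contains $H_2$; $K_n^{(3)}$ is the complete $3$-graph on $n$ vertices. For a graph $G$, $L_G$ is the $3$-graph on $V(G)\cup\{u\}$ ($u$ new) whose edges are the triples $\{u,v,w\}$ with $\{v,w\}\in E(G)$. For $3$-graphs $H,F$ and $v\in V(H)$, $H(v,F)$ is the $3$-graph on $|V(H)|+|V(F)|-1$ vertices formed by adding $|V(F)|-1$ copies of $v$ to $H$ (each copy lying in the edges obtained from edges of $H$ through $v$ by replacing $v$ with the copy), such that these copies together with $v$ induce a copy of $F$. -}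

module Defs where

open import Data.Nat using (ℕ; zero; suc; _+_; _*_; _^_; _≤_)
open import Data.Fin using (Fin; zero; suc; _≟_; splitAt)
open import Data.Bool using (Bool; true; false; not; _∧_; if_then_else_)
open import Data.Maybe using (Maybe; just; nothing)
open import Data.Sum using (_⊎_; inj₁; inj₂)
open import Data.Product using (Σ; _×_; _,_)
open import Data.Empty using (⊥-elim)
open import Relation.Nullary using (yes; no)
open import Relation.Nullary.Decidable using (isYes)
open import Relation.Binary.PropositionalEquality using (_≡_; refl; sym; trans; cong; cong₂)
open import Function.Definitions using (Injective)

eqb : ∀ {n} → Fin n → Fin n → Bool
eqb a b = isYes (a ≟ b)

eqb-sym : ∀ {n} (a b : Fin n) → eqb a b ≡ eqb b a
eqb-sym a b with a ≟ b | b ≟ a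
... | yes _ | yes _ = refl
... | no _  | no _  = refl
... | yes p | no q  = ⊥-elim (q (sym p))
... | no p  | yes q = ⊥-elim (p (sym q))

eqb-refl : ∀ {n} (a : Fin n) → eqb a a ≡ true
eqb-refl a with a ≟ a
... | yes _ = refl
... | no p  = ⊥-elim (p refl)

distinct3 : ∀ {n} → Fin n → Fin n → Fin n → Bool
distinct3 a b c = not (eqb a b) ∧ (not (eqb b c) ∧ not (eqb a c))

private
  ∧-lem₁ : ∀ p q r → p ∧ (q ∧ r) ≡ p ∧ (r ∧ q)
  ∧-lem₁ true true true = refl
  ∧-lem₁ true true false = refl
  ∧-lem₁ true false true = refl
  ∧-lem₁ true false false = refl
  ∧-lem₁ false q r = refl

  ∧-lem₂ : ∀ p q r → p ∧ (q ∧ r) ≡ r ∧ (q ∧ p)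
  ∧-lem₂ true true true = refl
  ∧-lem₂ true true false = refl
  ∧-lem₂ true false true = refl
  ∧-lem₂ true false false = refl
  ∧-lem₂ false true true = refl
  ∧-lem₂ false true false = refl
  ∧-lem₂ false false true = refl
  ∧-lem₂ false false false = refl

distinct3-sym₁₂ : ∀ {n} (a b c : Fin n) → distinct3 a b c ≡ distinct3 b a c
distinct3-sym₁₂ a b c rewrite eqb-sym b a =
  ∧-lem₁ (not (eqb a b)) (not (eqb b c)) (not (eqb a c))

distinct3-sym₂₃ : ∀ {n} (a b c : Fin n) → distinct3 a b c ≡ distinct3 a c b
distinct3-sym₂₃ a b c rewrite eqb-sym c b =
  ∧-lem₂ (not (eqb a b)) (not (eqb b c)) (not (eqb a c))

distinct3-irr : ∀ {n} (a c : Fin n) → distinct3 a a c ≡ false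
distinct3-irr a c rewrite eqb-refl a = refl

-- E a b c = true means {a,b,c} is an edge; E is symmetric and
-- vanishes whenever two arguments coincide, so it encodes a set of
-- 3-element subsets of Fin n.

record ThreeGraph (n : ℕ) : Set where
  field
    E     : Fin n → Fin n → Fin n → Bool
    sym₁₂ : ∀ a b c → E a b c ≡ E b a c
    sym₂₃ : ∀ a b c → E a b c ≡ E a c b
    irr   : ∀ a c → E a a c ≡ false

open ThreeGraph public

Contains : ∀ {N h} → ThreeGraph N → ThreeGraph h → Set
Contains {N} {h} G H =
  Σ (Fin h → Fin N) λ f →
    Injective _≡_ _≡_ f ×
    (∀ a b c → E H a b c ≡ true → E G (f a) (f b) (f c) ≡ true)

complement : ∀ {n} → ThreeGraph n → ThreeGraph n
complement G = record
  { E     = λ a b c → distinct3 a b c ∧ not (E G a b c)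
  ; sym₁₂ = λ a b c → cong₂ _∧_ (distinct3-sym₁₂ a b c) (cong not (sym₁₂ G a b c))
  ; sym₂₃ = λ a b c → cong₂ _∧_ (distinct3-sym₂₃ a b c) (cong not (sym₂₃ G a b c))
  ; irr   = λ a c → cong (_∧ not (E G a a c)) (distinct3-irr a c)
  }

K : (n : ℕ) → ThreeGraph n
K n = record
  { E = distinct3 ; sym₁₂ = distinct3-sym₁₂ ; sym₂₃ = distinct3-sym₂₃ ; irr = distinct3-irr }

RamseyProperty : ∀ {h₁ h₂} → ThreeGraph h₁ → ThreeGraph h₂ → ℕ → Set
RamseyProperty H₁ H₂ N = (G : ThreeGraph N) → Contains G H₁ ⊎ Contains (complement G) H₂

-- r(H₁,H₂) ≤ M, with r the least N having the Ramsey property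
-- (r ≤ M  iff  some N ≤ M has the property).
RamseyLE : ∀ {h₁ h₂} → ThreeGraph h₁ → ThreeGraph h₂ → ℕ → Set
RamseyLE H₁ H₂ M = Σ ℕ λ N → N ≤ M × RamseyProperty H₁ H₂ N

InPolyfact : ∀ {h} → ThreeGraph h → Set
InPolyfact H = Σ ℕ λ C → ∀ n → 2 ≤ n → RamseyLE H (K n) (n ^ (C * n))

record Graph (m : ℕ) : Set where
  field
    adj     : Fin m → Fin m → Bool
    adj-sym : ∀ v w → adj v w ≡ adj w v
    adj-irr : ∀ v → adj v v ≡ false

open Graph public

-- Link 3-graph L_G on Fin (suc m); the new vertex u is zero, and
-- the vertex v of G is suc v.
module _ {m : ℕ} (G : Graph m) where
  private
    LE : Fin (suc m) → Fin (suc m) → Fin (suc m) → Bool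
    LE zero    zero    c       = false
    LE zero    (suc v) zero    = false
    LE zero    (suc v) (suc w) = adj G v w
    LE (suc v) zero    zero    = false
    LE (suc v) zero    (suc w) = adj G v w
    LE (suc v) (suc w) zero    = adj G v w
    LE (suc v) (suc w) (suc x) = false

    LE-sym₁₂ : ∀ a b c → LE a b c ≡ LE b a c
    LE-sym₁₂ zero    zero    c       = refl
    LE-sym₁₂ zero    (suc v) zero    = refl
    LE-sym₁₂ zero    (suc v) (suc w) = refl
    LE-sym₁₂ (suc v) zero    zero    = refl
    LE-sym₁₂ (suc v) zero    (suc w) = refl
    LE-sym₁₂ (suc v) (suc w) zero    = adj-sym G v w
    LE-sym₁₂ (suc v) (suc w) (suc x) = refl

    LE-sym₂₃ : ∀ a b c → LE a b c ≡ LE a c b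
    LE-sym₂₃ zero    zero    zero    = refl
    LE-sym₂₃ zero    zero    (suc w) = refl
    LE-sym₂₃ zero    (suc v) zero    = refl
    LE-sym₂₃ zero    (suc v) (suc w) = adj-sym G v w
    LE-sym₂₃ (suc v) zero    zero    = refl
    LE-sym₂₃ (suc v) zero    (suc w) = refl
    LE-sym₂₃ (suc v) (suc w) zero    = refl
    LE-sym₂₃ (suc v) (suc w) (suc x) = refl

    LE-irr : ∀ a c → LE a a c ≡ false
    LE-irr zero    c       = refl
    LE-irr (suc v) zero    = adj-irr G v
    LE-irr (suc v) (suc w) = refl

  Link : ThreeGraph (suc m)
  Link = record { E = LE ; sym₁₂ = LE-sym₁₂ ; sym₂₃ = LE-sym₂₃ ; irr = LE-irr }

-- H(v,F): H on Fin h, F on Fin (suc k) (so |V(F)| - 1 = k copies).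
-- Vertex set Fin (h + k): the first h are the vertices of H, the last k
-- are the copies of v.  Vertex zero of F is identified with v, and
-- vertex suc i of F with the i-th copy.
--   * a triple lying entirely in {v} ∪ copies is an edge iff the
--     corresponding triple is an edge of F;
--   * otherwise it is an edge iff replacing every copy by v yields an
--     edge of H (this gives the edges of H and, for exactly one copy,
--     the edges of H through v with v replaced by that copy; triples
--     with v and a copy, or two copies, collapse to a non-edge).

private
  glue : ∀ {A : Set} → (A → A → A → Bool) → Bool → Maybe A → Maybe A → Maybe A → Bool
  glue EF d (just a) (just b) (just c) = EF a b c
  glue EF d (just a) (just b) nothing  = d
  glue EF d (just a) nothing  _        = d
  glue EF d nothing  _        _        = d

  glue-sym₁₂ : ∀ {A : Set} (EF : A → A → A → Bool) → (∀ a b c → EF a b c ≡ EF b a c) →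
               ∀ d x y z → glue EF d x y z ≡ glue EF d y x z
  glue-sym₁₂ EF s d (just a) (just b) (just c) = s a b c
  glue-sym₁₂ EF s d (just a) (just b) nothing  = refl
  glue-sym₁₂ EF s d (just a) nothing  (just c) = refl
  glue-sym₁₂ EF s d (just a) nothing  nothing  = refl
  glue-sym₁₂ EF s d nothing  (just b) (just c) = refl
  glue-sym₁₂ EF s d nothing  (just b) nothing  = refl
  glue-sym₁₂ EF s d nothing  nothing  z        = refl

  glue-sym₂₃ : ∀ {A : Set} (EF : A → A → A → Bool) → (∀ a b c → EF a b c ≡ EF a c b) →
               ∀ d x y z → glue EF d x y z ≡ glue EF d x z y
  glue-sym₂₃ EF s d (just a) (just b) (just c) = s a b c
  glue-sym₂₃ EF s d (just a) (just b) nothing  = refl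
  glue-sym₂₃ EF s d (just a) nothing  (just c) = refl
  glue-sym₂₃ EF s d (just a) nothing  nothing  = refl
  glue-sym₂₃ EF s d nothing  y        z        = refl

  glue-irr : ∀ {A : Set} (EF : A → A → A → Bool) → (∀ a c → EF a a c ≡ false) →
             ∀ x z → glue EF false x x z ≡ false
  glue-irr EF i (just a) (just c) = i a c
  glue-irr EF i (just a) nothing  = refl
  glue-irr EF i nothing  z        = refl

module _ {h k : ℕ} (H : ThreeGraph h) (v : Fin h) (F : ThreeGraph (suc k)) where
  private
    hp : Fin (h + k) → Fin h
    hp p with splitAt h p
    ... | inj₁ x = x
    ... | inj₂ _ = v

    fp : Fin (h + k) → Maybe (Fin (suc k))
    fp p with splitAt h p
    ... | inj₁ x = if eqb x v then just zero else nothing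
    ... | inj₂ i = just (suc i)

    EB : Fin (h + k) → Fin (h + k) → Fin (h + k) → Bool
    EB p q r = glue (E F) (E H (hp p) (hp q) (hp r)) (fp p) (fp q) (fp r)

    EB-sym₁₂ : ∀ p q r → EB p q r ≡ EB q p r
    EB-sym₁₂ p q r =
      trans (cong (λ d → glue (E F) d (fp p) (fp q) (fp r)) (sym₁₂ H (hp p) (hp q) (hp r)))
            (glue-sym₁₂ (E F) (sym₁₂ F) _ (fp p) (fp q) (fp r))

    EB-sym₂₃ : ∀ p q r → EB p q r ≡ EB p r q
    EB-sym₂₃ p q r =
      trans (cong (λ d → glue (E F) d (fp p) (fp q) (fp r)) (sym₂₃ H (hp p) (hp q) (hp r)))
            (glue-sym₂₃ (E F) (sym₂₃ F) _ (fp p) (fp q) (fp r))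

    EB-irr : ∀ p r → EB p p r ≡ false
    EB-irr p r =
      trans (cong (λ d → glue (E F) d (fp p) (fp p) (fp r)) (irr H (hp p) (hp r)))
            (glue-irr (E F) (irr F) (fp p) (fp r))

  blowup : ThreeGraph (h + k)
  blowup = record { E = EB ; sym₁₂ = EB-sym₁₂ ; sym₂₃ = EB-sym₂₃ ; irr = EB-irr }

-- Links: grow an independent set, each of whose vertices x waits for a clique of
-- size m in its link graph inside a shrinking pool.  Remove a vertex y from the pool
-- and colour each remaining pool vertex z by some x with {x,y,z} an edge, if there is
-- one.  By pigeonhole some colour class keeps an (n+2)-th of the pool: if its colour
-- is x, then y joins the clique of x; if it is uncoloured, y joins the independent set.
-- After at most (m+1)n steps a star or an independent n-set is complete, so
-- (n+2)^((m+1)n) vertices suffice for the star Link(K_m), and every L_G lies in a star.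
--
-- Blow-ups: on an R × L grid with R = r(H,K_n), every transversal of the columns spans
-- a copy of H (or we are done).  By pigeonhole, M = r(F,K_n) of these copies use the
-- same columns and agree outside the column of v, so they form a sunflower whose
-- centres span F (or we are done); together they form H(v,F).  Both sides are n^O(n).

module Submission where

open import Defs
open import Data.Bool using (Bool; true; false; not; _∧_)
import Data.Bool as Bool
open import Data.Bool.Properties using (¬-not)
open import Data.Empty using (⊥-elim)
open import Data.Fin using (Fin; zero; suc; _≟_; splitAt; join; combine; punchIn; punchOut; inject≤; finToFun; funToFin)
open import Data.Fin.Properties
  using (¬Fin0; suc-injective; inject≤-injective; join-splitAt; combine-injectiveˡ; combine-injectiveʳ;
         finToFun-funToFin; funToFin-finToFin; punchIn-punchOut; any?)
open import Data.Maybe using (Maybe; just; nothing; fromMaybe)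
open import Data.Maybe.Properties using (just-injective)
open import Data.Nat using (ℕ; zero; suc; _+_; _*_; _^_; _≤_; _<_; _≤?_; z≤n; s≤s; pred)
open import Data.Nat.Properties hiding (_≟_; suc-injective)
open import Data.Nat.Tactic.RingSolver using (solve-∀)
open import Data.Product using (Σ; ∃; _×_; _,_; proj₁; proj₂)
open import Data.Sum using (_⊎_; inj₁; inj₂; map₁; map₂)
open import Data.Vec.Functional using (_∷_; updateAt)
open import Data.Vec.Functional.Properties using (updateAt-updates; updateAt-minimal)
open import Function using (_∘_)
open import Function.Definitions using (Injective)
open import Relation.Nullary using (yes; no; ¬_)
open import Relation.Unary using (Decidable)
open import Relation.Binary.PropositionalEquality
  using (_≡_; _≢_; refl; sym; trans; cong; cong₂; subst; _≗_; module ≡-Reasoning)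

open import Algebra.Properties.Monoid.Sum +-0-monoid using (sum)

≢⇒eqb≡false : ∀ {n} {a b : Fin n} → a ≢ b → eqb a b ≡ false
≢⇒eqb≡false {a = a} {b} a≢b with a ≟ b
... | yes a≡b = ⊥-elim (a≢b a≡b)
... | no _    = refl

distinct3⇒≢ : ∀ {n} (a b c : Fin n) → distinct3 a b c ≡ true → a ≢ b × b ≢ c × a ≢ c
distinct3⇒≢ a b c d with a ≟ b | b ≟ c | a ≟ c
... | no a≢b | no b≢c | no a≢c = a≢b , b≢c , a≢c
distinct3⇒≢ a b c () | yes _ | _     | _
distinct3⇒≢ a b c () | no _  | yes _ | _
distinct3⇒≢ a b c () | no _  | no _  | yes _

≢⇒distinct3 : ∀ {n} {a b c : Fin n} → a ≢ b → b ≢ c → a ≢ c → distinct3 a b c ≡ true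
≢⇒distinct3 a≢b b≢c a≢c
  rewrite ≢⇒eqb≡false a≢b | ≢⇒eqb≡false b≢c | ≢⇒eqb≡false a≢c = refl

distinct3-injective : ∀ {s N} {ι : Fin s → Fin N} → Injective _≡_ _≡_ ι →
  ∀ a b c → distinct3 a b c ≡ true → distinct3 (ι a) (ι b) (ι c) ≡ true
distinct3-injective ι-inj a b c d =
  let a≢b , b≢c , a≢c = distinct3⇒≢ a b c d
  in ≢⇒distinct3 (a≢b ∘ ι-inj) (b≢c ∘ ι-inj) (a≢c ∘ ι-inj)

∧≡true : ∀ {x y} → x ∧ y ≡ true → x ≡ true × y ≡ true
∧≡true {true} {true} _ = refl , refl

∷-injective : ∀ {s N} {x : Fin N} {f : Fin s → Fin N} →
  (∀ j → x ≢ f j) → Injective _≡_ _≡_ f → Injective _≡_ _≡_ (x ∷ f)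
∷-injective x∉f f-inj {zero}  {zero}  _ = refl
∷-injective x∉f f-inj {zero}  {suc k} e = ⊥-elim (x∉f k e)
∷-injective x∉f f-inj {suc j} {zero}  e = ⊥-elim (x∉f j (sym e))
∷-injective x∉f f-inj {suc j} {suc k} e = cong suc (f-inj e)

E-cong : ∀ {N} (G : ThreeGraph N) {a a′ b b′ c c′} →
  a ≡ a′ → b ≡ b′ → c ≡ c′ → E G a b c ≡ E G a′ b′ c′
E-cong G refl refl refl = refl

E-rotate : ∀ {N} (G : ThreeGraph N) a b c → E G a b c ≡ E G b c a
E-rotate G a b c = trans (sym₁₂ G a b c) (sym₂₃ G b a c)

edge⇒distinct : ∀ {N} (G : ThreeGraph N) {a b c} → E G a b c ≡ true → a ≢ b × b ≢ c × a ≢ c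
edge⇒distinct G {a} {b} {c} e =
  (λ { refl → true≢false (trans (sym e) (irr G a c)) }) ,
  (λ { refl → true≢false (trans (sym e) (trans (E-rotate G a b b) (irr G b a))) }) ,
  (λ { refl → true≢false (trans (sym e) (trans (sym₂₃ G a b a) (irr G a b))) })
  where
  true≢false : true ≢ false
  true≢false ()

IsEmbedding : ∀ {N h} → ThreeGraph N → ThreeGraph h → (Fin h → Fin N) → Set
IsEmbedding G H f =
  Injective _≡_ _≡_ f × (∀ a b c → E H a b c ≡ true → E G (f a) (f b) (f c) ≡ true)

contains-trans : ∀ {a b c} {G : ThreeGraph a} {H : ThreeGraph b} {H′ : ThreeGraph c} →
  Contains G H → Contains H H′ → Contains G H′
contains-trans (f , f-inj , f-edge) (g , g-inj , g-edge) =
  f ∘ g , g-inj ∘ f-inj , λ a b c → f-edge (g a) (g b) (g c) ∘ g-edge a b c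

restrict : ∀ {N s} → ThreeGraph N → (Fin s → Fin N) → ThreeGraph s
restrict G ι = record
  { E     = λ a b c → E G (ι a) (ι b) (ι c)
  ; sym₁₂ = λ a b c → sym₁₂ G (ι a) (ι b) (ι c)
  ; sym₂₃ = λ a b c → sym₂₃ G (ι a) (ι b) (ι c)
  ; irr   = λ a c → irr G (ι a) (ι c)
  }

module _ {N s h} (G : ThreeGraph N) {H : ThreeGraph h} {ι : Fin s → Fin N}
         (ι-inj : Injective _≡_ _≡_ ι) where

  restrict-embedding : ∀ {f} → IsEmbedding (restrict G ι) H f → IsEmbedding G H (ι ∘ f)
  restrict-embedding (f-inj , f-edge) = f-inj ∘ ι-inj , f-edge

  complement-restrict-embedding : ∀ {f} →
    IsEmbedding (complement (restrict G ι)) H f → IsEmbedding (complement G) H (ι ∘ f)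
  complement-restrict-embedding {f} (f-inj , f-edge) = f-inj ∘ ι-inj , edge
    where
    edge : ∀ a b c → E H a b c ≡ true → E (complement G) (ι (f a)) (ι (f b)) (ι (f c)) ≡ true
    edge a b c e =
      let d , ¬e = ∧≡true (f-edge a b c e)
      in cong₂ _∧_ (distinct3-injective ι-inj (f a) (f b) (f c) d) ¬e

  restrict-contains : Contains (restrict G ι) H → Contains G H
  restrict-contains (f , f-emb) = ι ∘ f , restrict-embedding f-emb

  complement-restrict-contains : Contains (complement (restrict G ι)) H → Contains (complement G) H
  complement-restrict-contains (f , f-emb) = ι ∘ f , complement-restrict-embedding f-emb

ramsey-restrict : ∀ {N s h₁ h₂} {H₁ : ThreeGraph h₁} {H₂ : ThreeGraph h₂} (G : ThreeGraph N)
  {ι : Fin s → Fin N} → Injective _≡_ _≡_ ι →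
  RamseyProperty H₁ H₂ s → Contains G H₁ ⊎ Contains (complement G) H₂
ramsey-restrict {H₁ = H₁} {H₂} G {ι} ι-inj ramsey =
  Data.Sum.map (restrict-contains G {H₁} ι-inj) (complement-restrict-contains G {H₂} ι-inj)
               (ramsey (restrict G ι))

RamseyProperty-mono : ∀ {h₁ h₂ N N′} {H₁ : ThreeGraph h₁} {H₂ : ThreeGraph h₂} →
  N ≤ N′ → RamseyProperty H₁ H₂ N → RamseyProperty H₁ H₂ N′
RamseyProperty-mono {H₁ = H₁} {H₂} N≤N′ ramsey G =
  ramsey-restrict {H₁ = H₁} {H₂} G (λ {x} {y} → inject≤-injective N≤N′ N≤N′ x y) ramsey

RamseyProperty-contained : ∀ {h h′ h₂ N} {H : ThreeGraph h} {H′ : ThreeGraph h′} {H₂ : ThreeGraph h₂} →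
  Contains H H′ → RamseyProperty H H₂ N → RamseyProperty H′ H₂ N
RamseyProperty-contained {H = H} {H′} H⊇H′ ramsey G =
  map₁ (λ G⊇H → contains-trans {G = G} {H} {H′} G⊇H H⊇H′) (ramsey G)

InPolyfact-contained : ∀ {h h′} (H : ThreeGraph h) (H′ : ThreeGraph h′) →
  InPolyfact H → Contains H H′ → InPolyfact H′
InPolyfact-contained H H′ (C , bound) H⊇H′ = C , λ n 2≤n →
  let N , N≤ , ramsey = bound n 2≤n
  in N , N≤ , RamseyProperty-contained {H = H} {H′} {K n} H⊇H′ ramsey

Independent : ∀ {N i} → ThreeGraph N → (Fin i → Fin N) → Set
Independent G f = ∀ j k l → j ≢ k → k ≢ l → j ≢ l → E G (f j) (f k) (f l) ≡ false

independent⇒complement-K : ∀ {N n} {G : ThreeGraph N} {f : Fin n → Fin N} →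
  Injective _≡_ _≡_ f → Independent G f → Contains (complement G) (K n)
independent⇒complement-K {f = f} f-inj indep = f , f-inj , λ a b c d →
  let a≢b , b≢c , a≢c = distinct3⇒≢ a b c d
  in cong₂ _∧_ (distinct3-injective f-inj a b c d) (cong not (indep a b c a≢b b≢c a≢c))

∷-independent : ∀ {N i} {G : ThreeGraph N} {x : Fin N} {f : Fin i → Fin N} →
  (∀ j k → j ≢ k → E G x (f j) (f k) ≡ false) → Independent G f → Independent G (x ∷ f)
∷-independent {G = G} {x} {f} x-avoids indep = λ where
  zero    zero    _       x≢x _   _   → ⊥-elim (x≢x refl)
  zero    (suc k) zero    _   _   x≢x → ⊥-elim (x≢x refl)
  zero    (suc k) (suc l) _   k≢l _   → x-avoids k l (k≢l ∘ cong suc)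
  (suc j) zero    zero    _   x≢x _   → ⊥-elim (x≢x refl)
  (suc j) zero    (suc l) _   _   j≢l →
    trans (sym₁₂ G (f j) x (f l)) (x-avoids j l (j≢l ∘ cong suc))
  (suc j) (suc k) zero    j≢k _   _   →
    trans (sym (E-rotate G x (f j) (f k))) (x-avoids j k (j≢k ∘ cong suc))
  (suc j) (suc k) (suc l) j≢k k≢l j≢l →
    indep j k l (j≢k ∘ cong suc) (k≢l ∘ cong suc) (j≢l ∘ cong suc)

record Partition {n} (P : Fin n → Set) : Set where
  field
    {size₁ size₂} : ℕ
    sizes         : size₁ + size₂ ≡ n
    inside        : Fin size₁ → Fin n
    inside-inj    : Injective _≡_ _≡_ inside
    inside-holds  : ∀ z → P (inside z)
    outside       : Fin size₂ → Fin n
    outside-inj   : Injective _≡_ _≡_ outside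
    outside-fails : ∀ z → ¬ P (outside z)

partition : ∀ {n} {P : Fin n → Set} → Decidable P → Partition P
partition {zero} P? = record
  { sizes = refl
  ; inside = λ () ; inside-inj = λ {x} → ⊥-elim (¬Fin0 x) ; inside-holds = λ ()
  ; outside = λ () ; outside-inj = λ {x} → ⊥-elim (¬Fin0 x) ; outside-fails = λ ()
  }
partition {suc n} P? with P? zero | partition (P? ∘ suc)
... | yes P0 | Q = record
  { sizes = cong suc sizes
  ; inside = zero ∷ suc ∘ inside ; inside-inj = ∷-injective (λ _ ()) (inside-inj ∘ suc-injective)
  ; inside-holds = λ { zero → P0 ; (suc z) → inside-holds z }
  ; outside = suc ∘ outside ; outside-inj = outside-inj ∘ suc-injective
  ; outside-fails = outside-fails
  }
  where open Partition Q
... | no ¬P0 | Q = record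
  { sizes = trans (+-suc size₁ size₂) (cong suc sizes)
  ; inside = suc ∘ inside ; inside-inj = inside-inj ∘ suc-injective
  ; inside-holds = inside-holds
  ; outside = zero ∷ suc ∘ outside ; outside-inj = ∷-injective (λ _ ()) (outside-inj ∘ suc-injective)
  ; outside-fails = λ { zero → ¬P0 ; (suc z) → outside-fails z }
  }
  where open Partition Q

FibreEmbedding : ∀ {n p} → (Fin n → Fin p) → Fin p → ℕ → Set
FibreEmbedding {n} f b k = Σ (Fin k → Fin n) λ g → Injective _≡_ _≡_ g × (∀ z → f (g z) ≡ b)

pigeonhole-room : ∀ {k p s₁ s₂ n} → s₁ < k → s₁ + s₂ ≡ n → k + p * k < n → p * k < s₂
pigeonhole-room {k} {p} {s₁} {s₂} s₁<k refl room =
  +-cancelˡ-< k (p * k) s₂ (<-≤-trans room (+-monoˡ-≤ s₂ (<⇒≤ s₁<k)))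

pigeonhole : ∀ {n p} k (f : Fin n → Fin p) → p * k < n → ∃ λ b → FibreEmbedding f b k
pigeonhole {zero}  {p}     k f ()
pigeonhole {suc n} {zero}  k f _ = ⊥-elim (¬Fin0 (f zero))
pigeonhole {suc n} {suc p} k f room = ByZero.fibre (partition (λ z → f z ≟ zero))
  where
  module ByZero (P : Partition (λ z → f z ≡ zero)) where
    open Partition P

    lower : Fin size₂ → Fin p
    lower z = punchOut (outside-fails z ∘ sym)

    fibre : ∃ λ b → FibreEmbedding f b k
    fibre with k ≤? size₁
    ... | yes k≤ = zero , inside ∘ (λ z → inject≤ z k≤) ,
          (λ {x} {y} → inject≤-injective k≤ k≤ x y ∘ inside-inj) ,
          (λ z → inside-holds (inject≤ z k≤))
    ... | no k≰ with pigeonhole k lower (pigeonhole-room {p = p} (≰⇒> k≰) sizes room)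
    ...   | b , g , g-inj , g-fibre = suc b , outside ∘ g , g-inj ∘ outside-inj ,
          (λ z → trans (sym (punchIn-punchOut {i = zero} _)) (cong suc (g-fibre z)))

∀-⊎-distrib : ∀ {n} {A : Fin n → Set} {B : Set} → (∀ i → A i ⊎ B) → (∀ i → A i) ⊎ B
∀-⊎-distrib {zero}  f = inj₁ λ ()
∀-⊎-distrib {suc n} f with f zero | ∀-⊎-distrib (f ∘ suc)
... | inj₂ b | _      = inj₂ b
... | inj₁ _ | inj₂ b = inj₂ b
... | inj₁ a | inj₁ g = inj₁ λ { zero → a ; (suc i) → g i }

funToFin-cong : ∀ {m n} {f g : Fin m → Fin n} → f ≗ g → funToFin f ≡ funToFin g
funToFin-cong {zero}  _   = refl
funToFin-cong {suc m} f≗g = cong₂ combine (f≗g zero) (funToFin-cong (f≗g ∘ suc))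

funToFin-injective : ∀ {m n} {f g : Fin m → Fin n} → funToFin f ≡ funToFin g → f ≗ g
funToFin-injective {f = f} {g} eq x =
  trans (sym (finToFun-funToFin f x))
        (trans (cong (λ i → finToFun i x) eq) (finToFun-funToFin g x))

finToFun-injective : ∀ {m n} {i j : Fin (n ^ m)} → finToFun {n} {m} i ≗ finToFun j → i ≡ j
finToFun-injective {m} {n} {i} {j} eq = begin
  i                              ≡⟨ sym (funToFin-finToFin {m} {n} i) ⟩
  funToFin (finToFun {n} {m} i)  ≡⟨ funToFin-cong eq ⟩
  funToFin (finToFun {n} {m} j)  ≡⟨ funToFin-finToFin {m} {n} j ⟩
  j                              ∎
  where open ≡-Reasoning

sum-updateAt-pred : ∀ {i} (q : Fin i → ℕ) j {d} → q j ≡ suc d → suc (sum (updateAt q j pred)) ≡ sum q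
sum-updateAt-pred q zero    qj≡1+d rewrite qj≡1+d = refl
sum-updateAt-pred q (suc j) qj≡1+d =
  trans (sym (+-suc (q zero) _)) (cong (q zero +_) (sum-updateAt-pred (q ∘ suc) j qj≡1+d))

complete : (m : ℕ) → Graph m
complete m = record
  { adj = λ v w → not (eqb v w) ; adj-sym = λ v w → cong not (eqb-sym v w) ; adj-irr = λ v → cong not (eqb-refl v) }

Star : (m : ℕ) → ThreeGraph (suc m)
Star m = Link (complete m)

adj⇒≢ : ∀ {m} (G : Graph m) {v w} → adj G v w ≡ true → v ≢ w
adj⇒≢ G {v} e refl with trans (sym e) (adj-irr G v)
... | ()

link-edges : ∀ {m N} (G : Graph m) (T : ThreeGraph N) (f : Fin (suc m) → Fin N) →
  (∀ v w → adj G v w ≡ true → E T (f zero) (f (suc v)) (f (suc w)) ≡ true) →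
  ∀ a b c → E (Link G) a b c ≡ true → E T (f a) (f b) (f c) ≡ true
link-edges G T f link zero    (suc v) (suc w) e = link v w e
link-edges G T f link (suc v) zero    (suc w) e = trans (sym₁₂ T _ _ _) (link v w e)
link-edges G T f link (suc v) (suc w) zero    e = trans (sym (E-rotate T _ _ _)) (link v w e)
link-edges G T f link zero    zero    _       ()
link-edges G T f link zero    (suc v) zero    ()
link-edges G T f link (suc v) zero    zero    ()
link-edges G T f link (suc v) (suc w) (suc x) ()

Link⊆Star : ∀ {m} (G : Graph m) → Contains (Star m) (Link G)
Link⊆Star {m} G = (λ z → z) , (λ e → e) ,
  link-edges G (Star m) (λ z → z) (λ v w e → cong not (≢⇒eqb≡false (adj⇒≢ G e)))

pool-room : ∀ {i a n s} D → 1 ≤ D → i + suc a ≡ n → (2 + n) * D ≤ suc s → suc i * D < s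
pool-room {i} {a} {n} {s} D 1≤D i+1+a≡n room = begin-strict
  suc i * D      ≤⟨ *-monoˡ-≤ D 1+i≤n ⟩
  n * D          <⟨ +-monoˡ-≤ (n * D) 1≤D ⟩
  D + n * D      ≤⟨ ≤-pred (≤-trans (+-monoˡ-≤ (D + n * D) 1≤D) room) ⟩
  s              ∎
  where
  open ≤-Reasoning
  1+i≤n : suc i ≤ n
  1+i≤n = ≤-trans (m≤m+n (suc i) a) (≤-reflexive (trans (sym (+-suc i a)) i+1+a≡n))

budget-after-set-aside : ∀ {m a t} S → S + suc m * suc a ≤ suc t → m + S + suc m * a ≤ t
budget-after-set-aside {m} {a} S budget = ≤-pred (≤-trans (≤-reflexive (regroup m a S)) budget)
  where
  regroup : ∀ m a S → suc (m + S + suc m * a) ≡ S + suc m * suc a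
  regroup = solve-∀

module StarRamsey {N : ℕ} (G : ThreeGraph N) (m n : ℕ) where

  Outcome : Set
  Outcome = Contains G (Star m) ⊎ Contains (complement G) (K n)

  record LinkClique {s} (x : Fin N) (pool : Fin s → Fin N) (q : ℕ) : Set where
    constructor linkClique
    field
      members          : Fin q → Fin s
      members-injective : Injective _≡_ _≡_ members
      members-linked   : ∀ a b → a ≢ b → E G x (pool (members a)) (pool (members b)) ≡ true

  linkClique-empty : ∀ {s x} {pool : Fin s → Fin N} → LinkClique x pool 0
  linkClique-empty = linkClique (λ ()) (λ {x} → ⊥-elim (¬Fin0 x)) λ ()

  linkClique-map : ∀ {s r x q} {pool : Fin s → Fin N} (κ : Fin r → Fin s) →
    Injective _≡_ _≡_ κ → LinkClique x (pool ∘ κ) q → LinkClique x pool q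
  linkClique-map κ κ-inj (linkClique g g-inj g-linked) = linkClique (κ ∘ g) (g-inj ∘ κ-inj) g-linked

  linkClique-cons : ∀ {s x q} {pool : Fin (suc s) → Fin N} →
    (∀ z → E G x (pool zero) (pool (suc z)) ≡ true) →
    LinkClique x (pool ∘ suc) q → LinkClique x pool (suc q)
  linkClique-cons {x = x} red (linkClique g g-inj g-linked) =
    linkClique (zero ∷ suc ∘ g) (∷-injective (λ _ ()) (g-inj ∘ suc-injective)) λ where
      zero    zero    0≢0 → ⊥-elim (0≢0 refl)
      zero    (suc b) _   → red (g b)
      (suc a) zero    _   → trans (sym₂₃ G x _ _) (red (g a))
      (suc a) (suc b) a≢b → g-linked a b (a≢b ∘ cong suc)

  star-from-linkClique : ∀ {s y} {pool : Fin s → Fin N} → Injective _≡_ _≡_ pool →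
    (∀ z → y ≢ pool z) → LinkClique y pool m → Contains G (Star m)
  star-from-linkClique {y = y} {pool} pool-inj y∉pool (linkClique g g-inj g-linked) =
    y ∷ pool ∘ g , ∷-injective (y∉pool ∘ g) (g-inj ∘ pool-inj) ,
    link-edges (complete m) G (y ∷ pool ∘ g) (λ v w e → g-linked v w (adj⇒≢ (complete m) e))

  -- out is the growing independent set; out j becomes the centre of a star once the
  -- pool contains demand j more vertices of a clique of its link graph.  Every step
  -- lowers sum demand + (m+1)a, which budget bounds by the number t of steps left.
  record Stage (t i a s : ℕ) : Set where
    field
      i+a≡n                : i + a ≡ n
      pool                 : Fin s → Fin N
      pool-injective       : Injective _≡_ _≡_ pool
      pool-large           : (2 + n) ^ t ≤ s
      out                  : Fin i → Fin N
      out-injective        : Injective _≡_ _≡_ out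
      out∉pool             : ∀ j z → out j ≢ pool z
      out-independent      : Independent G out
      out-pairs-avoid-pool : ∀ j j′ z → j ≢ j′ → E G (out j) (out j′) (pool z) ≡ false
      demand               : Fin i → ℕ
      budget               : sum demand + suc m * a ≤ t
      pending              : ∀ j → LinkClique (out j) pool (demand j) → Outcome

  module Advance {t i a s} (S : Stage (suc t) i (suc a) (suc s))
                 (continue : ∀ {i a s} → Stage t i a s → Outcome) where
    open Stage S

    y : Fin N
    y = pool zero

    D : ℕ
    D = (2 + n) ^ t

    rest : Fin s → Fin N
    rest = pool ∘ suc

    rest-injective : Injective _≡_ _≡_ rest
    rest-injective = suc-injective ∘ pool-injective

    y∉rest : ∀ z → y ≢ rest z
    y∉rest z e with pool-injective e
    ... | ()

    classify : ∀ z → (∃ λ j → E G (out j) y (rest z) ≡ true)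
                   ⊎ (∀ j → E G (out j) y (rest z) ≡ false)
    classify z with any? (λ j → E G (out j) y (rest z) Bool.≟ true)
    ... | yes red = inj₁ red
    ... | no ¬red = inj₂ λ j → ¬-not λ e → ¬red (j , e)

    colour : Fin s → Fin (suc i)
    colour z = Data.Sum.[ suc ∘ proj₁ , (λ _ → zero) ] (classify z)

    colour-zero : ∀ z → colour z ≡ zero → ∀ j → E G (out j) y (rest z) ≡ false
    colour-zero z c≡0 with classify z
    ... | inj₂ blue = blue

    colour-suc : ∀ z j → colour z ≡ suc j → E G (out j) y (rest z) ≡ true
    colour-suc z j c≡1+j with classify z
    colour-suc z j refl | inj₁ (.j , red) = red

    set-aside : (g : Fin D → Fin s) → Injective _≡_ _≡_ g →
      (∀ z j → E G (out j) y (rest (g z)) ≡ false) → Stage t (suc i) a D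
    set-aside g g-inj blue = record
      { i+a≡n                = trans (sym (+-suc i a)) i+a≡n
      ; pool                 = rest ∘ g
      ; pool-injective       = g-inj ∘ rest-injective
      ; pool-large           = ≤-refl
      ; out                  = y ∷ out
      ; out-injective        = ∷-injective (λ j e → out∉pool j zero (sym e)) out-injective
      ; out∉pool             = λ { zero → y∉rest ∘ g ; (suc j) → out∉pool j ∘ suc ∘ g }
      ; out-independent      = ∷-independent {G = G}
          (λ j j′ j≢j′ → trans (E-rotate G y (out j) (out j′)) (out-pairs-avoid-pool j j′ zero j≢j′))
          out-independent
      ; out-pairs-avoid-pool = avoid
      ; demand               = m ∷ demand
      ; budget               = budget-after-set-aside {m} {a} (sum demand) budget
      ; pending              = λ where
          zero    → inj₁ ∘ star-from-linkClique (g-inj ∘ rest-injective) (y∉rest ∘ g)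
          (suc j) → pending j ∘ linkClique-map (suc ∘ g) (g-inj ∘ suc-injective)
      }
      where
      avoid : ∀ j j′ z → j ≢ j′ → E G ((y ∷ out) j) ((y ∷ out) j′) (rest (g z)) ≡ false
      avoid zero    zero     z 0≢0   = ⊥-elim (0≢0 refl)
      avoid zero    (suc j′) z _     = trans (sym₁₂ G y (out j′) (rest (g z))) (blue z j′)
      avoid (suc j) zero     z _     = blue z j
      avoid (suc j) (suc j′) z j≢j′ = out-pairs-avoid-pool j j′ (suc (g z)) (j≢j′ ∘ cong suc)

    shrink : ∀ j {d} → demand j ≡ suc d → (g : Fin D → Fin s) → Injective _≡_ _≡_ g →
      (∀ z → E G (out j) y (rest (g z)) ≡ true) → Stage t i (suc a) D
    shrink j {d} dj g g-inj red = record
      { i+a≡n                = i+a≡n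
      ; pool                 = rest ∘ g
      ; pool-injective       = g-inj ∘ rest-injective
      ; pool-large           = ≤-refl
      ; out                  = out
      ; out-injective        = out-injective
      ; out∉pool             = λ j → out∉pool j ∘ suc ∘ g
      ; out-independent      = out-independent
      ; out-pairs-avoid-pool = λ j j′ → out-pairs-avoid-pool j j′ ∘ suc ∘ g
      ; demand               = updateAt demand j pred
      ; budget               = ≤-pred (subst (λ x → x + suc m * suc a ≤ suc t)
                                             (sym (sum-updateAt-pred demand j dj)) budget)
      ; pending              = pending′
      }
      where
      grow : LinkClique (out j) (rest ∘ g) d → LinkClique (out j) pool (demand j)
      grow = subst (LinkClique (out j) pool) (sym dj)
           ∘ linkClique-map (zero ∷ suc ∘ g) (∷-injective (λ _ ()) (g-inj ∘ suc-injective))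
           ∘ linkClique-cons red
      pending′ : ∀ k → LinkClique (out k) (rest ∘ g) (updateAt demand j pred k) → Outcome
      pending′ k clique with k ≟ j
      ... | yes refl = pending j (grow (subst (LinkClique (out j) (rest ∘ g))
                         (trans (updateAt-updates j demand) (cong pred dj)) clique))
      ... | no k≢j = pending k (linkClique-map (suc ∘ g) (g-inj ∘ suc-injective)
                       (subst (LinkClique (out k) (rest ∘ g)) (updateAt-minimal k j demand k≢j) clique))

    outcome : Outcome
    outcome with pigeonhole D colour (pool-room D (m^n>0 (2 + n) t) i+a≡n pool-large)
    ... | zero  , g , g-inj , g-colour =
      continue (set-aside g g-inj (λ z → colour-zero (g z) (g-colour z)))
    ... | suc j , g , g-inj , g-colour with demand j in dj
    ...   | zero  = pending j (subst (LinkClique (out j) pool) (sym dj) linkClique-empty)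
    ...   | suc d = continue (shrink j dj g g-inj (λ z → colour-suc (g z) j (g-colour z)))

  run : ∀ t {i a s} → Stage t i a s → Outcome
  run t {a = zero} S with trans (sym (+-identityʳ _)) (Stage.i+a≡n S)
  ... | refl = inj₂ (independent⇒complement-K {G = G} (Stage.out-injective S) (Stage.out-independent S))
  run zero {a = suc a} S with ≤-trans (m≤n+m (suc m * suc a) _) (Stage.budget S)
  ... | ()
  run (suc t) {a = suc a} {s = zero} S with ≤-trans (m^n>0 (2 + n) (suc t)) (Stage.pool-large S)
  ... | ()
  run (suc t) {a = suc a} {s = suc s} S = Advance.outcome S (run t)

  initial : (2 + n) ^ (suc m * n) ≤ N → Stage (suc m * n) 0 n N
  initial large = record
    { i+a≡n = refl ; pool = λ z → z ; pool-injective = λ e → e ; pool-large = large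
    ; out = λ () ; out-injective = λ {x} → ⊥-elim (¬Fin0 x) ; out∉pool = λ ()
    ; out-independent = λ () ; out-pairs-avoid-pool = λ ()
    ; demand = λ () ; budget = ≤-refl ; pending = λ ()
    }

RamseyProperty-Star : ∀ m n → RamseyProperty (Star m) (K n) ((2 + n) ^ (suc m * n))
RamseyProperty-Star m n G = StarRamsey.run G m n _ (StarRamsey.initial G m n ≤-refl)

-- A vertex p of H(v,F) stands for the vertex base p of H (copies of v stand for v),
-- and layer p is its vertex in F when p is v or one of its copies.
module BlowupStructure {h k : ℕ} (H : ThreeGraph h) (v : Fin h) (F : ThreeGraph (suc k)) where

  base : Fin (h + k) → Fin h
  base p with splitAt h p
  ... | inj₁ x = x
  ... | inj₂ _ = v

  layer : Fin (h + k) → Maybe (Fin (suc k))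
  layer p with splitAt h p
  ... | inj₂ i = just (suc i)
  ... | inj₁ x with x ≟ v
  ...   | yes _ = just zero
  ...   | no _  = nothing

  glue : Bool → Maybe (Fin (suc k)) → Maybe (Fin (suc k)) → Maybe (Fin (suc k)) → Bool
  glue d (just a) (just b) (just c) = E F a b c
  glue d (just a) (just b) nothing  = d
  glue d (just a) nothing  _        = d
  glue d nothing  _        _        = d

  glue≡true : ∀ {d x y z} → glue d x y z ≡ true →
    (∃ λ a → ∃ λ b → ∃ λ c → x ≡ just a × y ≡ just b × z ≡ just c × E F a b c ≡ true) ⊎ d ≡ true
  glue≡true {x = just a}  {just b}  {just c}  e = inj₁ (a , b , c , refl , refl , refl , e)
  glue≡true {x = just a}  {just b}  {nothing} e = inj₂ e
  glue≡true {x = just a}  {nothing}           e = inj₂ e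
  glue≡true {x = nothing}                     e = inj₂ e

  blowup-edge : ∀ p q r →
    E (blowup H v F) p q r ≡ glue (E H (base p) (base q) (base r)) (layer p) (layer q) (layer r)
  blowup-edge p q r with splitAt h p | splitAt h q | splitAt h r
  ... | inj₁ x | inj₁ y | inj₁ w with x ≟ v | y ≟ v | w ≟ v
  ...   | yes _ | yes _ | yes _ = refl
  ...   | yes _ | yes _ | no _  = refl
  ...   | yes _ | no _  | yes _ = refl
  ...   | yes _ | no _  | no _  = refl
  ...   | no _  | yes _ | yes _ = refl
  ...   | no _  | yes _ | no _  = refl
  ...   | no _  | no _  | yes _ = refl
  ...   | no _  | no _  | no _  = refl
  blowup-edge p q r | inj₁ x | inj₁ y | inj₂ _ with x ≟ v | y ≟ v
  ...   | yes _ | yes _ = refl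
  ...   | yes _ | no _  = refl
  ...   | no _  | yes _ = refl
  ...   | no _  | no _  = refl
  blowup-edge p q r | inj₁ x | inj₂ _ | inj₁ w with x ≟ v | w ≟ v
  ...   | yes _ | yes _ = refl
  ...   | yes _ | no _  = refl
  ...   | no _  | yes _ = refl
  ...   | no _  | no _  = refl
  blowup-edge p q r | inj₁ x | inj₂ _ | inj₂ _ with x ≟ v
  ...   | yes _ = refl
  ...   | no _  = refl
  blowup-edge p q r | inj₂ _ | inj₁ y | inj₁ w with y ≟ v | w ≟ v
  ...   | yes _ | yes _ = refl
  ...   | yes _ | no _  = refl
  ...   | no _  | yes _ = refl
  ...   | no _  | no _  = refl
  blowup-edge p q r | inj₂ _ | inj₁ y | inj₂ _ with y ≟ v
  ...   | yes _ = refl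
  ...   | no _  = refl
  blowup-edge p q r | inj₂ _ | inj₂ _ | inj₁ w with w ≟ v
  ...   | yes _ = refl
  ...   | no _  = refl
  blowup-edge p q r | inj₂ _ | inj₂ _ | inj₂ _ = refl

  layer≡just⇒base≡v : ∀ {p a} → layer p ≡ just a → base p ≡ v
  layer≡just⇒base≡v {p} e with splitAt h p
  ... | inj₂ _ = refl
  ... | inj₁ x with x ≟ v
  ...   | yes x≡v = x≡v
  layer≡just⇒base≡v () | inj₁ x | no _

  layer≡nothing⇒base≢v : ∀ {p} → layer p ≡ nothing → base p ≢ v
  layer≡nothing⇒base≢v {p} e with splitAt h p
  layer≡nothing⇒base≢v () | inj₂ _
  ... | inj₁ x with x ≟ v
  layer≡nothing⇒base≢v () | inj₁ x | yes _
  ...   | no x≢v = x≢v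

  splitAt-injective : ∀ {p q} → splitAt h p ≡ splitAt h q → p ≡ q
  splitAt-injective {p} {q} e =
    trans (sym (join-splitAt h k p)) (trans (cong (join h k) e) (join-splitAt h k q))

  base-layer-injective : ∀ {p q} → base p ≡ base q → layer p ≡ layer q → p ≡ q
  base-layer-injective {p} {q} eb el with splitAt h p in sp | splitAt h q in sq
  ... | inj₁ x | inj₁ y = splitAt-injective (trans sp (trans (cong inj₁ eb) (sym sq)))
  ... | inj₂ i | inj₂ j = splitAt-injective (trans sp (trans (cong inj₂ (suc-injective (just-injective el))) (sym sq)))
  ... | inj₁ x | inj₂ j with x ≟ v
  base-layer-injective eb () | inj₁ x | inj₂ j | yes _
  base-layer-injective eb () | inj₁ x | inj₂ j | no _
  base-layer-injective eb el | inj₂ i | inj₁ y with y ≟ v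
  base-layer-injective eb () | inj₂ i | inj₁ y | yes _
  base-layer-injective eb () | inj₂ i | inj₁ y | no _

record Sunflower {N h} (G : ThreeGraph N) (H : ThreeGraph h) (v : Fin h) (M : ℕ) : Set where
  field
    petal            : Fin M → Fin h → Fin N
    petal-embeds     : ∀ z → IsEmbedding G H (petal z)
    petals-agree     : ∀ z z′ x → x ≢ v → petal z x ≡ petal z′ x
    centre-injective : Injective _≡_ _≡_ (λ z → petal z v)

  centre : Fin M → Fin N
  centre z = petal z v

  petal≢centre : ∀ z z′ {x} → x ≢ v → petal z x ≢ centre z′
  petal≢centre z z′ {x} x≢v e = x≢v (proj₁ (petal-embeds z′) (trans (petals-agree z′ z x x≢v) e))

module _ {N h k M} {G : ThreeGraph N} {H : ThreeGraph h} {v : Fin h} {F : ThreeGraph (suc k)}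
         (S : Sunflower G H v M) where
  open Sunflower S
  open BlowupStructure H v F

  -- The copies of v go to the centres of the petals ψ a; every other vertex lies in
  -- all petals, in particular in the petal of ψ zero.
  module _ (ψ : Fin (suc k) → Fin M) (ψ-embeds : IsEmbedding (restrict G centre) F ψ) where

    Φ : Fin (h + k) → Fin N
    Φ p = petal (ψ (fromMaybe zero (layer p))) (base p)

    InPetal : Fin (h + k) → Fin (suc k) → Set
    InPetal p a = ∀ b → layer p ≡ just b → b ≡ a

    Φ-just : ∀ {p a} → layer p ≡ just a → Φ p ≡ centre (ψ a)
    Φ-just {p} e = trans (cong (λ l → petal (ψ (fromMaybe zero l)) (base p)) e)
                         (cong (petal _) (layer≡just⇒base≡v e))

    Φ-nothing : ∀ {p} → layer p ≡ nothing → Φ p ≡ petal (ψ zero) (base p)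
    Φ-nothing {p} e = cong (λ l → petal (ψ (fromMaybe zero l)) (base p)) e

    Φ-in-petal : ∀ p a → InPetal p a → Φ p ≡ petal (ψ a) (base p)
    Φ-in-petal p a only with layer p in e
    ... | nothing = petals-agree _ _ (base p) (layer≡nothing⇒base≢v e)
    ... | just b  = cong (λ c → petal (ψ c) (base p)) (only b refl)

    common-petal : ∀ p q r → E H (base p) (base q) (base r) ≡ true →
      ∃ λ a → InPetal p a × InPetal q a × InPetal r a
    common-petal p q r e with edge⇒distinct H e | layer p in ep | layer q in eq | layer r in er
    ... | bp≢bq , _ , _ | just _ | just _ | _ =
      ⊥-elim (bp≢bq (trans (layer≡just⇒base≡v ep) (sym (layer≡just⇒base≡v eq))))
    ... | _ , _ , bp≢br | just _ | nothing | just _ =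
      ⊥-elim (bp≢br (trans (layer≡just⇒base≡v ep) (sym (layer≡just⇒base≡v er))))
    ... | _ , bq≢br , _ | nothing | just _ | just _ =
      ⊥-elim (bq≢br (trans (layer≡just⇒base≡v eq) (sym (layer≡just⇒base≡v er))))
    ... | _ | just a  | nothing | nothing = a , (λ _ → sym ∘ just-injective) , (λ _ ()) , (λ _ ())
    ... | _ | nothing | just b  | nothing = b , (λ _ ()) , (λ _ → sym ∘ just-injective) , (λ _ ())
    ... | _ | nothing | nothing | just c  = c , (λ _ ()) , (λ _ ()) , (λ _ → sym ∘ just-injective)
    ... | _ | nothing | nothing | nothing = zero , (λ _ ()) , (λ _ ()) , (λ _ ())

    Φ-edge : ∀ p q r → E (blowup H v F) p q r ≡ true → E G (Φ p) (Φ q) (Φ r) ≡ true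
    Φ-edge p q r e with glue≡true (trans (sym (blowup-edge p q r)) e)
    ... | inj₁ (a , b , c , ep , eq , er , eF) =
      trans (E-cong G (Φ-just ep) (Φ-just eq) (Φ-just er)) (proj₂ ψ-embeds a b c eF)
    ... | inj₂ eH with common-petal p q r eH
    ...   | a , ip , iq , ir =
      trans (E-cong G (Φ-in-petal p a ip) (Φ-in-petal q a iq) (Φ-in-petal r a ir))
            (proj₂ (petal-embeds (ψ a)) _ _ _ eH)

    Φ-injective : Injective _≡_ _≡_ Φ
    Φ-injective {p} {q} e = by-layers (layer p) (layer q) refl refl
      where
      by-layers : ∀ lp lq → layer p ≡ lp → layer q ≡ lq → p ≡ q
      by-layers nothing nothing ep eq = base-layer-injective
        (proj₁ (petal-embeds (ψ zero)) (trans (sym (Φ-nothing ep)) (trans e (Φ-nothing eq))))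
        (trans ep (sym eq))
      by-layers (just a) (just b) ep eq
        with proj₁ ψ-embeds (centre-injective (trans (sym (Φ-just ep)) (trans e (Φ-just eq))))
      ... | refl = base-layer-injective
        (trans (layer≡just⇒base≡v ep) (sym (layer≡just⇒base≡v eq))) (trans ep (sym eq))
      by-layers nothing (just b) ep eq = ⊥-elim (petal≢centre _ (ψ b) (layer≡nothing⇒base≢v ep)
        (trans (sym (Φ-nothing ep)) (trans e (Φ-just eq))))
      by-layers (just a) nothing ep eq = ⊥-elim (petal≢centre _ (ψ a) (layer≡nothing⇒base≢v eq)
        (trans (sym (Φ-nothing eq)) (trans (sym e) (Φ-just ep))))

  sunflower-blowup : Contains (restrict G centre) F → Contains G (blowup H v F)
  sunflower-blowup (ψ , ψ-embeds) = Φ ψ ψ-embeds , Φ-injective ψ ψ-embeds , Φ-edge ψ ψ-embeds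

module Transversals {h : ℕ} (H : ThreeGraph h) (v : Fin h) (R′ M : ℕ) where

  R L : ℕ
  R = suc R′
  L = suc (R ^ h * M)

  transversal : (Fin R → Fin L) → Fin R → Fin (R * L)
  transversal σ a = combine a (σ a)

  transversal-injective : ∀ σ → Injective _≡_ _≡_ (transversal σ)
  transversal-injective σ {a} {b} = combine-injectiveˡ a (σ a) b (σ b)

  few-keys : (R ^ h * L ^ R′) * M < L ^ R
  few-keys = begin-strict
    (R ^ h * L ^ R′) * M     ≡⟨ regroup (R ^ h) (L ^ R′) M ⟩
    R ^ h * M * L ^ R′       <⟨ m<n+m _ (m^n>0 L R′) ⟩
    L ^ R′ + R ^ h * M * L ^ R′ ∎
    where
    open ≤-Reasoning
    regroup : ∀ a b c → (a * b) * c ≡ a * c * b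
    regroup = solve-∀

  module _ (G : ThreeGraph (R * L)) (copy : ∀ i → Contains (restrict G (transversal (finToFun i))) H) where

    σ : Fin (L ^ R) → Fin R → Fin L
    σ = finToFun

    φ : Fin (L ^ R) → Fin h → Fin R
    φ i = proj₁ (copy i)

    rows-off-centre : Fin (L ^ R) → Fin R′ → Fin L
    rows-off-centre i = σ i ∘ punchIn (φ i v)

    -- the columns of the copy of H in transversal i, and its rows outside the column of v
    key : Fin (L ^ R) → Fin (R ^ h * L ^ R′)
    key i = combine (funToFin (φ i)) (funToFin (rows-off-centre i))

    same-key⇒same-columns : ∀ {i j} → key i ≡ key j → φ i ≗ φ j
    same-key⇒same-columns {i} {j} e = funToFin-injective (combine-injectiveˡ
      (funToFin (φ i)) (funToFin (rows-off-centre i)) (funToFin (φ j)) (funToFin (rows-off-centre j)) e)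

    same-key⇒same-rows-off-centre : ∀ {i j} → key i ≡ key j → rows-off-centre i ≗ rows-off-centre j
    same-key⇒same-rows-off-centre {i} {j} e = funToFin-injective (combine-injectiveʳ
      (funToFin (φ i)) (funToFin (rows-off-centre i)) (funToFin (φ j)) (funToFin (rows-off-centre j)) e)

    same-key⇒rows-agree : ∀ {i j} → key i ≡ key j → ∀ col → φ i v ≢ col → σ i col ≡ σ j col
    same-key⇒rows-agree {i} {j} e col c≢col = begin
      σ i col                         ≡⟨ cong (σ i) (sym (punchIn-punchOut c≢col)) ⟩
      σ i (punchIn (φ i v) y)         ≡⟨ same-key⇒same-rows-off-centre e y ⟩
      σ j (punchIn (φ j v) y)         ≡⟨ cong (λ c → σ j (punchIn c y)) (sym (same-key⇒same-columns e v)) ⟩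
      σ j (punchIn (φ i v) y)         ≡⟨ cong (σ j) (punchIn-punchOut c≢col) ⟩
      σ j col                         ∎
      where
      open ≡-Reasoning
      y = punchOut c≢col

    sunflower-of-keys : (g : Fin M → Fin (L ^ R)) → Injective _≡_ _≡_ g →
      (∀ z z′ → key (g z) ≡ key (g z′)) → Sunflower G H v M
    sunflower-of-keys g g-inj same = record
      { petal            = petal
      ; petal-embeds     = λ z → restrict-embedding G {H} (transversal-injective (σ (g z))) (proj₂ (copy (g z)))
      ; petals-agree     = agree
      ; centre-injective = λ {z} {z′} e → g-inj (finToFun-injective (rows-agree-everywhere z z′ e))
      }
      where
      petal : Fin M → Fin h → Fin (R * L)
      petal z = transversal (σ (g z)) ∘ φ (g z)

      agree : ∀ z z′ x → x ≢ v → petal z x ≡ petal z′ x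
      agree z z′ x x≢v = begin
        combine (φ (g z) x) (σ (g z) (φ (g z) x))   ≡⟨ cong (combine {R} {L} (φ (g z) x))
                                                         (same-key⇒rows-agree (same z z′) _
                                                           (x≢v ∘ sym ∘ proj₁ (proj₂ (copy (g z))))) ⟩
        combine (φ (g z) x) (σ (g z′) (φ (g z) x))  ≡⟨ cong (λ c → combine {R} {L} c (σ (g z′) c))
                                                           (same-key⇒same-columns (same z z′) x) ⟩
        combine (φ (g z′) x) (σ (g z′) (φ (g z′) x)) ∎
        where open ≡-Reasoning

      rows-agree-everywhere : ∀ z z′ → petal z v ≡ petal z′ v → σ (g z) ≗ σ (g z′)
      rows-agree-everywhere z z′ e col with φ (g z) v ≟ col
      ... | yes refl = trans (combine-injectiveʳ (φ (g z) v) (σ (g z) (φ (g z) v))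
                                                 (φ (g z′) v) (σ (g z′) (φ (g z′) v)) e)
                             (cong (σ (g z′)) (sym (same-key⇒same-columns (same z z′) v)))
      ... | no c≢col = same-key⇒rows-agree (same z z′) col c≢col

    sunflower : Sunflower G H v M
    sunflower with pigeonhole M key few-keys
    ... | _ , g , g-inj , g-key = sunflower-of-keys g g-inj λ z z′ → trans (g-key z) (sym (g-key z′))

  RamseyProperty-blowup : ∀ {k n} (F : ThreeGraph (suc k)) →
    RamseyProperty H (K n) R → RamseyProperty F (K n) M → RamseyProperty (blowup H v F) (K n) (R * L)
  RamseyProperty-blowup {n = n} F ramsey-H ramsey-F G
    with ∀-⊎-distrib (λ i → map₂ (complement-restrict-contains G {K n} (transversal-injective (finToFun i)))
                                 (ramsey-H (restrict G (transversal (finToFun i)))))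
  ... | inj₂ independent = inj₂ independent
  ... | inj₁ copies =
    Data.Sum.map (sunflower-blowup {F = F} S) (complement-restrict-contains G {K n} (Sunflower.centre-injective S))
                 (ramsey-F (restrict G (Sunflower.centre S)))
    where S = sunflower G copies

2≤n^n : ∀ {n} → 2 ≤ n → 2 ≤ n ^ n
2≤n^n {n@(suc _)} 2≤n =
  ≤-trans 2≤n (≤-trans (≤-reflexive (sym (*-identityʳ n))) (^-monoʳ-≤ n {1} {n} (s≤s z≤n)))

suc≤^ : ∀ {n x} e → 2 ≤ n → x ≤ n ^ e → suc x ≤ n ^ (n + e)
suc≤^ {n@(suc _)} {x} e 2≤n x≤ = begin
  suc x               ≤⟨ +-mono-≤ (m^n>0 n e) x≤ ⟩
  n ^ e + n ^ e       ≡⟨ cong (n ^ e +_) (sym (+-identityʳ (n ^ e))) ⟩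
  2 * n ^ e           ≤⟨ *-monoˡ-≤ (n ^ e) (2≤n^n 2≤n) ⟩
  n ^ n * n ^ e       ≡⟨ sym (^-distribˡ-+-* n n e) ⟩
  n ^ (n + e)         ∎
  where open ≤-Reasoning

blowup-bound : ∀ {n h CH CF NH NF} → 2 ≤ n → NH ≤ n ^ (CH * n) → NF ≤ n ^ (CF * n) →
  suc NH * suc (suc NH ^ h * NF) ≤ n ^ ((suc CH * suc h + suc CF) * n)
blowup-bound {n} {h} {CH} {CF} {NH} {NF} 2≤n NH≤ NF≤ = begin
  suc NH * suc (suc NH ^ h * NF)        ≤⟨ *-mono-≤ 1+NH≤ (suc≤^ _ 2≤n inner) ⟩
  n ^ a * n ^ (n + (a * h + CF * n))    ≡⟨ sym (^-distribˡ-+-* n a _) ⟩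
  n ^ (a + (n + (a * h + CF * n)))      ≡⟨ cong (n ^_) (exponent n CH CF h) ⟩
  n ^ ((suc CH * suc h + suc CF) * n)   ∎
  where
  open ≤-Reasoning
  a = n + CH * n
  exponent : ∀ n CH CF h →
    (n + CH * n) + (n + ((n + CH * n) * h + CF * n)) ≡ (suc CH * suc h + suc CF) * n
  exponent = solve-∀
  1+NH≤ : suc NH ≤ n ^ a
  1+NH≤ = suc≤^ (CH * n) 2≤n NH≤
  inner : suc NH ^ h * NF ≤ n ^ (a * h + CF * n)
  inner = begin
    suc NH ^ h * NF              ≤⟨ *-mono-≤ (^-monoˡ-≤ h 1+NH≤) NF≤ ⟩
    (n ^ a) ^ h * n ^ (CF * n)   ≡⟨ cong (_* n ^ (CF * n)) (^-*-assoc n a h) ⟩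
    n ^ (a * h) * n ^ (CF * n)   ≡⟨ sym (^-distribˡ-+-* n (a * h) (CF * n)) ⟩
    n ^ (a * h + CF * n)         ∎

InPolyfact-blowup : ∀ {h k} (H : ThreeGraph h) (F : ThreeGraph (suc k)) →
  InPolyfact H → InPolyfact F → (v : Fin h) → InPolyfact (blowup H v F)
InPolyfact-blowup {h} H F (CH , bound-H) (CF , bound-F) v = suc CH * suc h + suc CF , λ n 2≤n →
  let NH , NH≤ , ramsey-H = bound-H n 2≤n
      NF , NF≤ , ramsey-F = bound-F n 2≤n
  in _ , blowup-bound {h = h} {CH} {CF} 2≤n NH≤ NF≤ ,
     Transversals.RamseyProperty-blowup H v NH NF F (RamseyProperty-mono {H₁ = H} {K n} (n≤1+n NH) ramsey-H) ramsey-F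

2+n≤n^2 : ∀ {n} → 2 ≤ n → 2 + n ≤ n ^ 2
2+n≤n^2 {n} 2≤n = begin
  2 + n       ≤⟨ +-monoˡ-≤ n 2≤n ⟩
  n + n       ≡⟨ cong (n +_) (sym (+-identityʳ n)) ⟩
  2 * n       ≤⟨ *-monoˡ-≤ n 2≤n ⟩
  n * n       ≡⟨ cong (n *_) (sym (*-identityʳ n)) ⟩
  n ^ 2       ∎
  where open ≤-Reasoning

InPolyfact-Star : ∀ m → InPolyfact (Star m)
InPolyfact-Star m = 2 * suc m , λ n 2≤n → _ , star-bound n 2≤n , RamseyProperty-Star m n
  where
  star-bound : ∀ n → 2 ≤ n → (2 + n) ^ (suc m * n) ≤ n ^ (2 * suc m * n)
  star-bound n 2≤n = begin
    (2 + n) ^ (suc m * n)      ≤⟨ ^-monoˡ-≤ (suc m * n) (2+n≤n^2 2≤n) ⟩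
    (n ^ 2) ^ (suc m * n)      ≡⟨ ^-*-assoc n 2 (suc m * n) ⟩
    n ^ (2 * (suc m * n))      ≡⟨ cong (n ^_) (sym (*-assoc 2 (suc m) n)) ⟩
    n ^ (2 * suc m * n)        ∎
    where open ≤-Reasoning

proposition6p6 :
    (∀ (m : ℕ) (G : Graph m) → InPolyfact (Link G))
    × (∀ {h h′ : ℕ} (H : ThreeGraph h) (H′ : ThreeGraph h′) →
         InPolyfact H → Contains H H′ → InPolyfact H′)
    × (∀ {h k : ℕ} (H : ThreeGraph h) (F : ThreeGraph (suc k)) →
         InPolyfact H → InPolyfact F → (v : Fin h) → InPolyfact (blowup H v F))
proposition6p6 =
  (λ m G → InPolyfact-contained (Star m) (Link G) (InPolyfact-Star m) (Link⊆Star G)) ,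
  InPolyfact-contained ,
  InPolyfact-blowup
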